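{- Let $\mathcal{M}=(W,R,V)$ be a Kripke model, $w\in W$, $\varphi$ a sentence of the modal $\mu$-calculus and $\Gamma>0$ an ordinal. Then the $\Gamma$-bounded evaluation game $(\mathcal{M},w,\varphi,\Gamma)$ is positionally determined: exactly one of the players Eloise and Abelard has a winning strategy, where strategies are functions of the current position only.
   Context: Formulae: $\varphi ::= p \mid \neg p \mid X \mid \varphi\vee\varphi \mid \varphi\wedge\varphi \mid \Diamond\varphi \mid \Box\varphi \mid \mu X\varphi \mid \nu X\varphi$ ($p$ proposition symbols, $X$ label symbols); a sentence has no free label symbols. $\mathrm{Subf}(\varphi)$ is the set of nodes of the syntax tree, $\mathrm{Subf}_{\mu\nu}(\varphi)$ those of the form $\mu X\psi$ or $\nu X\psi$, and $\mathrm{rf}(X)$ for an atomic occurrence $X$ is the closest enclosing $\mu X$/$\nu X$ operator occurrence binding it. Kripke model $\mathcal{M}=(W,R,V)$, $V$ a valuation of proposition symbols. The game $(\mathcal{M},w_0,\varphi_0,\Gamma)$: positions $(w,\varphi,c)$ with $\varphi\in\mathrm{Subf}(\varphi_0)$ and clock mapping $c:\mathrm{Subf}_{\mu\nu}(\varphi_0)\to\{\gamma\mid\gamma\le\Gamma\}$; initial position $(w_0,\varphi_0,c_0)$, $c_0\equiv\Gamma$. At $(w,p,c)$ Eloise wins iff $w\in V(p)$, at $(w,\neg p,c)$ iff $w\notin V(p)$, otherwise Abelard wins. At $\psi\vee\theta$ Eloise, at $\psi\wedge\theta$ Abelard, chooses the next position $(w,\psi,c)$ or $(w,\theta,c)$.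 At $(w,\Diamond\psi,c)$ Eloise chooses $v$ with $wRv$, next $(v,\psi,c)$, Abelard winning if there is none; at $(w,\Box\psi,c)$ Abelard chooses, Eloise winning if there is none. At $(w,\mu X\psi,c)$ Eloise (at $\nu X\psi$ Abelard) chooses $\gamma<\Gamma$; next $(w,\psi,c[\gamma/\mu X\psi])$ (resp. $c[\gamma/\nu X\psi]$). At $(w,X,c)$ with $\gamma=c(\mathrm{rf}(X))$: if $\mathrm{rf}(X)=\mu X\psi$, Abelard wins if $\gamma=0$, otherwise Eloise selects $\gamma'<\gamma$ and the next position is $(w,\psi,c')$ with $c'(\mu X\psi)=\gamma'$, $c'(\theta)=\Gamma$ for each $\theta\in\mathrm{Subf}_{\mu\nu}(\varphi_0)$ in the syntax tree of $\psi$, $c'=c$ elsewhere; if $\mathrm{rf}(X)=\nu X\psi$, symmetrically Eloise wins if $\gamma=0$ and otherwise Abelard selects $\gamma'<\gamma$. A strategy for a player is a (partial) mapping from positions to legal choices at the positions where that player moves; it is winning if that player wins every play in which they follow it. -}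

module Defs where

open import Level using (0ℓ)
open import Data.Nat using (ℕ; _≡ᵇ_)
open import Data.Bool using (Bool; true; false; if_then_else_; _∨_)
open import Data.Maybe using (Maybe; just; nothing)
open import Data.List using (List; []; _∷_)
open import Data.List.Membership.Propositional using (_∈_)
open import Data.Product using (Σ; _×_; _,_)
open import Data.Unit using (⊤)
open import Data.Empty using (⊥)
open import Relation.Nullary using (¬_)
open import Relation.Binary.PropositionalEquality using (_≡_)
open import Relation.Binary.Core using (Rel)
open import Relation.Binary.Structures using (IsStrictTotalOrder)
open import Induction.WellFounded using (WellFounded)
open import Data.Sum using (_⊎_)

data Fm : Set where
  prop  : ℕ → Fm
  nprop : ℕ → Fm
  var   : ℕ → Fm
  _∨ᶠ_  : Fm → Fm → Fm
  _∧ᶠ_  : Fm → Fm → Fm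
  ◇     : Fm → Fm
  □     : Fm → Fm
  μ     : ℕ → Fm → Fm
  ν     : ℕ → Fm → Fm

data Scoped : List ℕ → Fm → Set where
  sprop  : ∀ {Δ p} → Scoped Δ (prop p)
  snprop : ∀ {Δ p} → Scoped Δ (nprop p)
  svar   : ∀ {Δ X} → X ∈ Δ → Scoped Δ (var X)
  sor    : ∀ {Δ φ ψ} → Scoped Δ φ → Scoped Δ ψ → Scoped Δ (φ ∨ᶠ ψ)
  sand   : ∀ {Δ φ ψ} → Scoped Δ φ → Scoped Δ ψ → Scoped Δ (φ ∧ᶠ ψ)
  sdia   : ∀ {Δ φ} → Scoped Δ φ → Scoped Δ (◇ φ)
  sbox   : ∀ {Δ φ} → Scoped Δ φ → Scoped Δ (□ φ)
  smu    : ∀ {Δ X φ} → Scoped (X ∷ Δ) φ → Scoped Δ (μ X φ)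
  snu    : ∀ {Δ X φ} → Scoped (X ∷ Δ) φ → Scoped Δ (ν X φ)

Sentence : Fm → Set
Sentence φ = Scoped [] φ

-- Nodes of the syntax tree of φ₀ (Subf(φ₀)): a node labelled ψ is a
-- path from the root, recorded leaf-to-root.

data Path (φ₀ : Fm) : Fm → Set where
  root : Path φ₀ φ₀
  ∨l   : ∀ {φ ψ} → Path φ₀ (φ ∨ᶠ ψ) → Path φ₀ φ
  ∨r   : ∀ {φ ψ} → Path φ₀ (φ ∨ᶠ ψ) → Path φ₀ ψ
  ∧l   : ∀ {φ ψ} → Path φ₀ (φ ∧ᶠ ψ) → Path φ₀ φ
  ∧r   : ∀ {φ ψ} → Path φ₀ (φ ∧ᶠ ψ) → Path φ₀ ψ
  ◇c   : ∀ {φ} → Path φ₀ (◇ φ) → Path φ₀ φ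
  □c   : ∀ {φ} → Path φ₀ (□ φ) → Path φ₀ φ
  μc   : ∀ {X φ} → Path φ₀ (μ X φ) → Path φ₀ φ
  νc   : ∀ {X φ} → Path φ₀ (ν X φ) → Path φ₀ φ

module _ {φ₀ : Fm} where

  eqNode : ∀ {ψ θ} → Path φ₀ ψ → Path φ₀ θ → Bool
  eqNode root   root   = true
  eqNode (∨l p) (∨l q) = eqNode p q
  eqNode (∨r p) (∨r q) = eqNode p q
  eqNode (∧l p) (∧l q) = eqNode p q
  eqNode (∧r p) (∧r q) = eqNode p q
  eqNode (◇c p) (◇c q) = eqNode p q
  eqNode (□c p) (□c q) = eqNode p q
  eqNode (μc p) (μc q) = eqNode p q
  eqNode (νc p) (νc q) = eqNode p q
  eqNode _      _      = false

  -- below b t: t is a proper descendant of b (t lies in the syntax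
  -- tree of the body of b)
  below : ∀ {ψ θ} → Path φ₀ ψ → Path φ₀ θ → Bool
  below b root   = false
  below b (∨l p) = eqNode b p ∨ below b p
  below b (∨r p) = eqNode b p ∨ below b p
  below b (∧l p) = eqNode b p ∨ below b p
  below b (∧r p) = eqNode b p ∨ below b p
  below b (◇c p) = eqNode b p ∨ below b p
  below b (□c p) = eqNode b p ∨ below b p
  below b (μc p) = eqNode b p ∨ below b p
  below b (νc p) = eqNode b p ∨ below b p

  data Binder : Set where
    muB : (X : ℕ) (ψ : Fm) → Path φ₀ (μ X ψ) → Binder
    nuB : (X : ℕ) (ψ : Fm) → Path φ₀ (ν X ψ) → Binder

  findBinder : ℕ → ∀ {ψ} → Path φ₀ ψ → Maybe Binder
  findBinder X root   = nothing
  findBinder X (∨l p) = findBinder X p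
  findBinder X (∨r p) = findBinder X p
  findBinder X (∧l p) = findBinder X p
  findBinder X (∧r p) = findBinder X p
  findBinder X (◇c p) = findBinder X p
  findBinder X (□c p) = findBinder X p
  findBinder X (μc {Y} {ψ} p) =
    if X ≡ᵇ Y then just (muB Y ψ p) else findBinder X p
  findBinder X (νc {Y} {ψ} p) =
    if X ≡ᵇ Y then just (nuB Y ψ p) else findBinder X p

  rf : ∀ {X} → Path φ₀ (var X) → Maybe Binder
  rf {X} p = findBinder X p

data IsFix : Fm → Set where
  isμ : ∀ {X ψ} → IsFix (μ X ψ)
  isν : ∀ {X ψ} → IsFix (ν X ψ)

FixNode : Fm → Set
FixNode φ₀ = Σ Fm λ ψ → IsFix ψ × Path φ₀ ψ

record Kripke : Set₁ where
  field
    W : Set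
    R : W → W → Set
    V : ℕ → W → Set

-- The ordinals {γ | γ ≤ Γ}, presented (up to isomorphism) as a
-- well-ordered set with a greatest element Γ.
record OrdinalsUpTo : Set₁ where
  field
    Ord          : Set
    _<_          : Rel Ord 0ℓ
    isSTO        : IsStrictTotalOrder _≡_ _<_
    wellFounded  : WellFounded _<_
    Γ            : Ord
    Γ-greatest   : ∀ γ → γ < Γ ⊎ γ ≡ Γ

Positive : OrdinalsUpTo → Set
Positive Ω = Σ Ord λ γ → γ < Γ
  where open OrdinalsUpTo Ω

data Player : Set where
  Eloise Abelard : Player

module Game (𝓜 : Kripke) (Ω : OrdinalsUpTo) (φ₀ : Fm) where
  open Kripke 𝓜
  open OrdinalsUpTo Ω

  Clock : Set
  Clock = FixNode φ₀ → Ord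

  record Pos : Set where
    constructor pos
    field
      world : W
      {fm}  : Fm
      node  : Path φ₀ fm
      clock : Clock

  setClock : Clock → ∀ {ψ} → Path φ₀ ψ → Ord → Clock
  setClock c b γ (θ , f , t) = if eqNode t b then γ else c (θ , f , t)

  resetClock : Clock → ∀ {ψ} → Path φ₀ ψ → Ord → Clock
  resetClock c b γ (θ , f , t) =
    if eqNode t b then γ else (if below b t then Γ else c (θ , f , t))

  -- What happens at a position: either the play ends (Eloise wins iff
  -- the given proposition holds, Abelard wins otherwise), or a player
  -- chooses one of the legal moves M, leading to the next position.
  data Rule : Set₁ where
    end  : Set → Rule
    move : Player → (M : Set) → (M → Pos) → Rule

  rule : Pos → Rule
  rule (pos w {prop p}  n c) = end (V p w)
  rule (pos w {nprop p} n c) = end (¬ V p w)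
  rule (pos w {φ ∨ᶠ ψ} n c) =
    move Eloise Bool λ b → if b then pos w (∨l n) c else pos w (∨r n) c
  rule (pos w {φ ∧ᶠ ψ} n c) =
    move Abelard Bool λ b → if b then pos w (∧l n) c else pos w (∧r n) c
  rule (pos w {◇ φ} n c) =
    move Eloise (Σ W (R w)) λ { (v , _) → pos v (◇c n) c }
  rule (pos w {□ φ} n c) =
    move Abelard (Σ W (R w)) λ { (v , _) → pos v (□c n) c }
  rule (pos w {μ X φ} n c) =
    move Eloise (Σ Ord (_< Γ)) λ { (γ , _) → pos w (μc n) (setClock c n γ) }
  rule (pos w {ν X φ} n c) =
    move Abelard (Σ Ord (_< Γ)) λ { (γ , _) → pos w (νc n) (setClock c n γ) }
  rule (pos w {var X} n c) with rf n
  ... | nothing = end ⊥     -- free label: impossible for sentences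
  ... | just (muB Y ψ b) =
    move Eloise (Σ Ord (_< c (μ Y ψ , isμ , b)))
      λ { (γ' , _) → pos w (μc b) (resetClock c b γ') }
  ... | just (nuB Y ψ b) =
    move Abelard (Σ Ord (_< c (ν Y ψ , isν , b)))
      λ { (γ' , _) → pos w (νc b) (resetClock c b γ') }
  -- (if γ = 0 the moving player has no legal choice and loses)

  StratAt : Player → Rule → Set
  StratAt P       (end E)             = ⊤
  StratAt Eloise  (move Eloise M f)   = Maybe M
  StratAt Eloise  (move Abelard M f)  = ⊤
  StratAt Abelard (move Eloise M f)   = ⊤
  StratAt Abelard (move Abelard M f)  = Maybe M

  Strategy : Player → Set
  Strategy P = (s : Pos) → StratAt P (rule s)

  WinStep : (P : Player) (r : Rule) → StratAt P r → (Pos → Set) → Set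
  WinStep Eloise  (end E)            _  Win = E
  WinStep Abelard (end E)            _  Win = ¬ E
  WinStep Eloise  (move Eloise M f)  st Win = Σ M λ m → st ≡ just m × Win (f m)
  WinStep Eloise  (move Abelard M f) _  Win = (m : M) → Win (f m)
  WinStep Abelard (move Eloise M f)  _  Win = (m : M) → Win (f m)
  WinStep Abelard (move Abelard M f) st Win = Σ M λ m → st ≡ just m × Win (f m)

  -- P wins every play from s in which P follows σ (all such plays are
  -- finite; the predicate is the inductive (well-founded) play tree).
  data Wins (P : Player) (σ : Strategy P) : Pos → Set where
    wins : ∀ {s} → WinStep P (rule s) (σ s) (Wins P σ) → Wins P σ s

  initial : W → Pos
  initial w₀ = pos w₀ root (λ _ → Γ)

  HasWinningStrategy : Player → W → Set
  HasWinningStrategy P w₀ = Σ (Strategy P) λ σ → Wins P σ (initial w₀)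

-- Every play of the game is finite.  Label the ancestors of the current
-- node, root first, by the current clock value at fixpoint nodes and by Γ
-- at all other nodes, and pad with a top element ∞ up to the height of φ.
-- A move to a child turns an ∞ into an ordinal and keeps the entries above
-- it; a move from a label back to the body of its binder keeps the entries
-- above the binder (the clocks there are untouched) and lowers the binder's
-- entry.  So positions descend in the lexicographic order on these
-- vectors, which is well founded.  Backward induction along this order,
-- with excluded middle to decide whether a move into Eloise's winning
-- region exists, yields positional winning strategies; and two winning
-- strategies of opposite players produce a common play won by both.

module Submission where

open import Defs
open import Level using (0ℓ)
open import Axiom.ExcludedMiddle using (ExcludedMiddle)
open import Data.Bool using (true; false; _∨_)
open import Data.Empty using (⊥)
open import Data.Fin using (toℕ)
open import Data.Maybe using (just; nothing)
open import Data.Nat using (ℕ; zero; suc; _+_; _≤_; _<_; _⊔_; _≟_; _≡ᵇ_; s≤s; z<s; s<s)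
open import Data.Nat.Properties
  using (≤-refl; ≤-trans; ≤-reflexive; <⇒≤; <⇒≢; <-asym; ≤-<-trans; +-suc; +-monoʳ-≤;
         m≤m⊔n; m≤n⊔m; m≤m+n; m≤n⇒m≤1+n)
open import Data.Product using (Σ; _×_; _,_; proj₂)
open import Data.Sum using (_⊎_; inj₁; inj₂)
open import Data.Sum.Relation.Binary.LeftOrder using (_⊎-<_; ₁∼₂; ₁∼₁; ⊎-<-wellFounded)
open import Data.Unit using (⊤; tt)
open import Data.Vec using (Vec; tabulate)
open import Data.Vec.Relation.Binary.Lex.Strict using (Lex-<; this; next; <-wellFounded)
open import Function using (_∘_; const)
open import Induction.WellFounded using (WellFounded; Acc; acc; module Subrelation)
open import Relation.Binary.Core using (Rel)
open import Relation.Binary.Construct.Never using (Never)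
open import Relation.Binary.Construct.On using () renaming (wellFounded to on-wellFounded)
open import Relation.Binary.PropositionalEquality
  using (_≡_; _≢_; _≗_; refl; sym; trans; cong; subst₂; respʳ; module ≡-Reasoning)
open import Relation.Nullary using (¬_; Dec; yes; no; contradiction)
open import Relation.Nullary.Decidable using (decidable-stable)

module _ {a} {A : Set a} where

  _[_]≔_ : (ℕ → A) → ℕ → A → ℕ → A
  (f [ d ]≔ x) j with j ≟ d
  ... | yes _ = x
  ... | no  _ = f j

  []≔-hit : ∀ (f : ℕ → A) d {x} → (f [ d ]≔ x) d ≡ x
  []≔-hit f d with d ≟ d
  ... | yes _   = refl
  ... | no  d≢d = contradiction refl d≢d

  []≔-miss : ∀ (f : ℕ → A) {d x j} → j ≢ d → (f [ d ]≔ x) j ≡ f j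
  []≔-miss f {d} {j = j} j≢d with j ≟ d
  ... | yes j≡d = contradiction j≡d j≢d
  ... | no  _   = refl

  []≔-cong : ∀ {f g : ℕ → A} {d x y} → x ≡ y → f ≗ g → (f [ d ]≔ x) ≗ (g [ d ]≔ y)
  []≔-cong {d = d} x≡y f≗g j with j ≟ d
  ... | yes _ = x≡y
  ... | no  _ = f≗g j

  []≔-constant-beyond : ∀ {f : ℕ → A} {d x y} → (∀ {j} → d ≤ j → f j ≡ y) →
                        ∀ {j} → suc d ≤ j → (f [ d ]≔ x) j ≡ y
  []≔-constant-beyond f≡y d<j = trans ([]≔-miss _ (<⇒≢ d<j ∘ sym)) (f≡y (<⇒≤ d<j))

module _ {a ℓ} {A : Set a} {_≺_ : Rel A ℓ} where

  tabulate-Lex : ∀ {n} (f g : ℕ → A) {i} → i < n → (∀ {j} → j < i → f j ≡ g j) → f i ≺ g i →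
                 Lex-< _≡_ _≺_ (tabulate {n = n} (f ∘ toℕ)) (tabulate {n = n} (g ∘ toℕ))
  tabulate-Lex {suc n} f g {zero}  _         _    fi≺gi = this fi≺gi refl
  tabulate-Lex {suc n} f g {suc i} (s≤s i<n) same fi≺gi =
    next (same z<s) (tabulate-Lex (f ∘ suc) (g ∘ suc) i<n (same ∘ s<s) fi≺gi)

module WellFoundedGame (𝓜 : Kripke) (Ω : OrdinalsUpTo) (φ₀ : Fm) where
  open Game 𝓜 Ω φ₀

  Descending : Rel Pos 0ℓ → Pos → Rule → Set
  Descending _≺_ s (end _)       = ⊤
  Descending _≺_ s (move _ _ to) = ∀ m → to m ≺ s

  Forces : Rule → (Pos → Set) → Set
  Forces (end E)             X = E
  Forces (move Eloise  M to) X = Σ M (X ∘ to)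
  Forces (move Abelard M to) X = ∀ m → X (to m)

  data EloiseRegion : Pos → Set where
    forced : ∀ {s} → Forces (rule s) EloiseRegion → EloiseRegion s

  Escapes : Rule → Set
  Escapes (move Abelard M to) = Σ M λ m → ¬ EloiseRegion (to m)
  Escapes _                   = ⊤

  not-both : ∀ {σ τ s} → Wins Eloise σ s → Wins Abelard τ s → ⊥
  not-both {σ} {τ} {s} (wins e) (wins a) with rule s | σ s | τ s
  not-both (wins e)           (wins a)           | end _            | _ | _ = a e
  not-both (wins (m , _ , e)) (wins a)           | move Eloise  _ _ | _ | _ = not-both e (a m)
  not-both (wins e)           (wins (m , _ , a)) | move Abelard _ _ | _ | _ = not-both (e m) a

  module _ (lem : ExcludedMiddle 0ℓ) where

    eloiseChoice : (r : Rule) → Dec (Forces r EloiseRegion) → StratAt Eloise r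
    eloiseChoice (end _)            _             = tt
    eloiseChoice (move Eloise  _ _) (yes (m , _)) = just m
    eloiseChoice (move Eloise  _ _) (no _)        = nothing
    eloiseChoice (move Abelard _ _) _             = tt

    abelardChoice : (r : Rule) → Dec (Escapes r) → StratAt Abelard r
    abelardChoice (end _)            _             = tt
    abelardChoice (move Eloise  _ _) _             = tt
    abelardChoice (move Abelard _ _) (yes (m , _)) = just m
    abelardChoice (move Abelard _ _) (no _)        = nothing

    eloise : Strategy Eloise
    eloise s = eloiseChoice (rule s) lem

    abelard : Strategy Abelard
    abelard s = abelardChoice (rule s) lem

    module _ {_≺_ : Rel Pos 0ℓ} (≺-wf : WellFounded _≺_)
             (descending : ∀ s → Descending _≺_ s (rule s)) where

      eloise-wins : ∀ {s} → EloiseRegion s → Wins Eloise eloise s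
      eloise-wins = go (≺-wf _)
        where
        go : ∀ {s} → Acc _≺_ s → EloiseRegion s → Wins Eloise eloise s
        go {s} (acc rec) (forced win) = wins (step (rule s) lem (descending s) win)
          where
          step : (r : Rule) (d : Dec (Forces r EloiseRegion)) → Descending _≺_ s r →
                 Forces r EloiseRegion → WinStep Eloise r (eloiseChoice r d) (Wins Eloise eloise)
          step (end _)            _                 _    e    = e
          step (move Eloise  _ _) (yes (m , win'))  desc _    = m , refl , go (rec (desc m)) win'
          step (move Eloise  _ _) (no ¬win)         _    win' = contradiction win' ¬win
          step (move Abelard _ _) _                 desc win' = λ m → go (rec (desc m)) (win' m)

      abelard-wins : ∀ {s} → ¬ EloiseRegion s → Wins Abelard abelard s
      abelard-wins = go (≺-wf _)
        where
        go : ∀ {s} → Acc _≺_ s → ¬ EloiseRegion s → Wins Abelard abelard s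
        go {s} (acc rec) ¬win = wins (step (rule s) lem (descending s) (¬win ∘ forced))
          where
          step : (r : Rule) (d : Dec (Escapes r)) → Descending _≺_ s r →
                 ¬ Forces r EloiseRegion → WinStep Abelard r (abelardChoice r d) (Wins Abelard abelard)
          step (end _)            _                _    ¬e = ¬e
          step (move Eloise  _ _) _                desc ¬f = λ m → go (rec (desc m)) (¬f ∘ (m ,_))
          step (move Abelard _ _) (yes (m , lose)) desc _  = m , refl , go (rec (desc m)) lose
          step (move Abelard _ _) (no trapped)     _    ¬f =
            contradiction (λ m → decidable-stable lem (trapped ∘ (m ,_))) ¬f

child-bound : ∀ {d a b h} → a ≤ b → d + suc b ≤ h → suc d + a ≤ h
child-bound {d} {a} a≤b bound =
  ≤-trans (≤-reflexive (sym (+-suc d a))) (≤-trans (+-monoʳ-≤ d (s≤s a≤b)) bound)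

height : Fm → ℕ
height (prop _)  = 0
height (nprop _) = 0
height (var _)   = 0
height (φ ∨ᶠ ψ)  = suc (height φ ⊔ height ψ)
height (φ ∧ᶠ ψ)  = suc (height φ ⊔ height ψ)
height (◇ φ)     = suc (height φ)
height (□ φ)     = suc (height φ)
height (μ _ φ)   = suc (height φ)
height (ν _ φ)   = suc (height φ)

module _ {φ₀ : Fm} where

  depth : ∀ {ψ} → Path φ₀ ψ → ℕ
  depth root   = 0
  depth (∨l p) = suc (depth p)
  depth (∨r p) = suc (depth p)
  depth (∧l p) = suc (depth p)
  depth (∧r p) = suc (depth p)
  depth (◇c p) = suc (depth p)
  depth (□c p) = suc (depth p)
  depth (μc p) = suc (depth p)
  depth (νc p) = suc (depth p)

  depth+height≤height : ∀ {ψ} (p : Path φ₀ ψ) → depth p + height ψ ≤ height φ₀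
  depth+height≤height root   = ≤-refl
  depth+height≤height (∨l p) = child-bound (m≤m⊔n _ _) (depth+height≤height p)
  depth+height≤height (∨r p) = child-bound (m≤n⊔m _ _) (depth+height≤height p)
  depth+height≤height (∧l p) = child-bound (m≤m⊔n _ _) (depth+height≤height p)
  depth+height≤height (∧r p) = child-bound (m≤n⊔m _ _) (depth+height≤height p)
  depth+height≤height (◇c p) = child-bound ≤-refl (depth+height≤height p)
  depth+height≤height (□c p) = child-bound ≤-refl (depth+height≤height p)
  depth+height≤height (μc p) = child-bound ≤-refl (depth+height≤height p)
  depth+height≤height (νc p) = child-bound ≤-refl (depth+height≤height p)

  depth≤height : ∀ {ψ} (p : Path φ₀ ψ) → depth p ≤ height φ₀
  depth≤height p = ≤-trans (m≤m+n _ _) (depth+height≤height p)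

  eqNode-refl : ∀ {ψ} (p : Path φ₀ ψ) → eqNode p p ≡ true
  eqNode-refl root   = refl
  eqNode-refl (∨l p) = eqNode-refl p
  eqNode-refl (∨r p) = eqNode-refl p
  eqNode-refl (∧l p) = eqNode-refl p
  eqNode-refl (∧r p) = eqNode-refl p
  eqNode-refl (◇c p) = eqNode-refl p
  eqNode-refl (□c p) = eqNode-refl p
  eqNode-refl (μc p) = eqNode-refl p
  eqNode-refl (νc p) = eqNode-refl p

  eqNode⇒depth≡ : ∀ {ψ θ} (p : Path φ₀ ψ) (q : Path φ₀ θ) → eqNode p q ≡ true → depth p ≡ depth q
  eqNode⇒depth≡ root   root   _ = refl
  eqNode⇒depth≡ (∨l p) (∨l q) e = cong suc (eqNode⇒depth≡ p q e)
  eqNode⇒depth≡ (∨r p) (∨r q) e = cong suc (eqNode⇒depth≡ p q e)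
  eqNode⇒depth≡ (∧l p) (∧l q) e = cong suc (eqNode⇒depth≡ p q e)
  eqNode⇒depth≡ (∧r p) (∧r q) e = cong suc (eqNode⇒depth≡ p q e)
  eqNode⇒depth≡ (◇c p) (◇c q) e = cong suc (eqNode⇒depth≡ p q e)
  eqNode⇒depth≡ (□c p) (□c q) e = cong suc (eqNode⇒depth≡ p q e)
  eqNode⇒depth≡ (μc p) (μc q) e = cong suc (eqNode⇒depth≡ p q e)
  eqNode⇒depth≡ (νc p) (νc q) e = cong suc (eqNode⇒depth≡ p q e)

  below⇒depth< : ∀ {ψ θ} (b : Path φ₀ ψ) (t : Path φ₀ θ) → below b t ≡ true → depth b < depth t
  atOrBelow⇒depth≤ : ∀ {ψ θ} (b : Path φ₀ ψ) (p : Path φ₀ θ) →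
                     (eqNode b p ∨ below b p) ≡ true → depth b ≤ depth p

  below⇒depth< b (∨l p) e = s≤s (atOrBelow⇒depth≤ b p e)
  below⇒depth< b (∨r p) e = s≤s (atOrBelow⇒depth≤ b p e)
  below⇒depth< b (∧l p) e = s≤s (atOrBelow⇒depth≤ b p e)
  below⇒depth< b (∧r p) e = s≤s (atOrBelow⇒depth≤ b p e)
  below⇒depth< b (◇c p) e = s≤s (atOrBelow⇒depth≤ b p e)
  below⇒depth< b (□c p) e = s≤s (atOrBelow⇒depth≤ b p e)
  below⇒depth< b (μc p) e = s≤s (atOrBelow⇒depth≤ b p e)
  below⇒depth< b (νc p) e = s≤s (atOrBelow⇒depth≤ b p e)

  atOrBelow⇒depth≤ b p e with eqNode b p in same
  ... | true  = ≤-reflexive (eqNode⇒depth≡ b p same)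
  ... | false = <⇒≤ (below⇒depth< b p e)

  depth<⇒¬eqNode : ∀ {ψ θ} (t : Path φ₀ ψ) (n : Path φ₀ θ) → depth t < depth n → eqNode t n ≡ false
  depth<⇒¬eqNode t n t<n with eqNode t n in same
  ... | false = refl
  ... | true  = contradiction (eqNode⇒depth≡ t n same) (<⇒≢ t<n)

  depth<⇒¬below : ∀ {ψ θ} (b : Path φ₀ ψ) (t : Path φ₀ θ) → depth t < depth b → below b t ≡ false
  depth<⇒¬below b t t<b with below b t in inside
  ... | false = refl
  ... | true  = contradiction (below⇒depth< b t inside) (<-asym t<b)

module Termination (𝓜 : Kripke) (Ω : OrdinalsUpTo) (φ₀ : Fm) where
  open OrdinalsUpTo Ω renaming (_<_ to _<ᵒ_)
  open Game 𝓜 Ω φ₀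
  open WellFoundedGame 𝓜 Ω φ₀ using (Descending)

  Entry : Set
  Entry = Ord ⊎ ⊤

  _<ᴱ_ : Rel Entry 0ℓ
  _<ᴱ_ = _<ᵒ_ ⊎-< Never

  ∞ : Entry
  ∞ = inj₂ tt

  profile : ∀ {ψ} → Path φ₀ ψ → Clock → ℕ → Entry
  profile root   c = const ∞
  profile (∨l p) c = profile p c [ depth p ]≔ inj₁ Γ
  profile (∨r p) c = profile p c [ depth p ]≔ inj₁ Γ
  profile (∧l p) c = profile p c [ depth p ]≔ inj₁ Γ
  profile (∧r p) c = profile p c [ depth p ]≔ inj₁ Γ
  profile (◇c p) c = profile p c [ depth p ]≔ inj₁ Γ
  profile (□c p) c = profile p c [ depth p ]≔ inj₁ Γ
  profile (μc {X} {ψ} p) c = profile p c [ depth p ]≔ inj₁ (c (μ X ψ , isμ , p))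
  profile (νc {X} {ψ} p) c = profile p c [ depth p ]≔ inj₁ (c (ν X ψ , isν , p))

  profile-beyond : ∀ {ψ} (p : Path φ₀ ψ) c {j} → depth p ≤ j → profile p c j ≡ ∞
  profile-beyond root   c _ = refl
  profile-beyond (∨l p) c   = []≔-constant-beyond (profile-beyond p c)
  profile-beyond (∨r p) c   = []≔-constant-beyond (profile-beyond p c)
  profile-beyond (∧l p) c   = []≔-constant-beyond (profile-beyond p c)
  profile-beyond (∧r p) c   = []≔-constant-beyond (profile-beyond p c)
  profile-beyond (◇c p) c   = []≔-constant-beyond (profile-beyond p c)
  profile-beyond (□c p) c   = []≔-constant-beyond (profile-beyond p c)
  profile-beyond (μc p) c   = []≔-constant-beyond (profile-beyond p c)
  profile-beyond (νc p) c   = []≔-constant-beyond (profile-beyond p c)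

  AgreeAbove : ℕ → Clock → Clock → Set
  AgreeAbove d c c' = ∀ {θ} (f : IsFix θ) (t : Path φ₀ θ) → depth t < d → c (θ , f , t) ≡ c' (θ , f , t)

  AgreeAbove-weaken : ∀ {d c c'} → AgreeAbove (suc d) c c' → AgreeAbove d c c'
  AgreeAbove-weaken agree f t = agree f t ∘ m≤n⇒m≤1+n

  profile-agree : ∀ {ψ} (p : Path φ₀ ψ) {c c'} → AgreeAbove (depth p) c c' → profile p c ≗ profile p c'
  profile-agree root   _     _ = refl
  profile-agree (∨l p) agree   = []≔-cong refl (profile-agree p (AgreeAbove-weaken agree))
  profile-agree (∨r p) agree   = []≔-cong refl (profile-agree p (AgreeAbove-weaken agree))
  profile-agree (∧l p) agree   = []≔-cong refl (profile-agree p (AgreeAbove-weaken agree))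
  profile-agree (∧r p) agree   = []≔-cong refl (profile-agree p (AgreeAbove-weaken agree))
  profile-agree (◇c p) agree   = []≔-cong refl (profile-agree p (AgreeAbove-weaken agree))
  profile-agree (□c p) agree   = []≔-cong refl (profile-agree p (AgreeAbove-weaken agree))
  profile-agree (μc p) agree   = []≔-cong (cong inj₁ (agree isμ p ≤-refl)) (profile-agree p (AgreeAbove-weaken agree))
  profile-agree (νc p) agree   = []≔-cong (cong inj₁ (agree isν p ≤-refl)) (profile-agree p (AgreeAbove-weaken agree))

  setClock-agree : ∀ {ψ} (n : Path φ₀ ψ) c γ → AgreeAbove (depth n) (setClock c n γ) c
  setClock-agree n c γ f t t<n rewrite depth<⇒¬eqNode t n t<n = refl

  resetClock-agree : ∀ {ψ} (b : Path φ₀ ψ) c γ → AgreeAbove (depth b) (resetClock c b γ) c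
  resetClock-agree b c γ f t t<b rewrite depth<⇒¬eqNode t b t<b | depth<⇒¬below b t t<b = refl

  setClock-hit : ∀ {θ} (f : IsFix θ) (n : Path φ₀ θ) c γ → setClock c n γ (θ , f , n) ≡ γ
  setClock-hit f n c γ rewrite eqNode-refl n = refl

  resetClock-hit : ∀ {θ} (f : IsFix θ) (b : Path φ₀ θ) c γ → resetClock c b γ (θ , f , b) ≡ γ
  resetClock-hit f b c γ rewrite eqNode-refl b = refl

  measure : Pos → Vec Entry (suc (height φ₀))
  measure (pos _ n c) = tabulate (profile n c ∘ toℕ)

  record _≺_ (s' s : Pos) : Set where
    constructor descent
    field lex : Lex-< _≡_ _<ᴱ_ (measure s') (measure s)

  ≺-wellFounded : WellFounded _≺_
  ≺-wellFounded = Subrelation.wellFounded _≺_.lex (on-wellFounded measure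
    (<-wellFounded trans (respʳ _<ᴱ_) (⊎-<-wellFounded wellFounded λ _ → acc λ ())))

  profile-descent : ∀ {w w' ψ ψ'} {n : Path φ₀ ψ} {n' : Path φ₀ ψ'} {c c'} d → d ≤ height φ₀ →
                    (∀ {j} → j < d → profile n' c' j ≡ profile n c j) → profile n' c' d <ᴱ profile n c d →
                    pos w' n' c' ≺ pos w n c
  profile-descent {n = n} {n'} {c} {c'} d d≤h same smaller =
    descent (tabulate-Lex (profile n' c') (profile n c) (s≤s d≤h) same smaller)

  descend : ∀ {w w' ψ ψ'} {n : Path φ₀ ψ} {n' : Path φ₀ ψ'} {c c' γ} →
            profile n' c' ≗ profile n c [ depth n ]≔ inj₁ γ → pos w' n' c' ≺ pos w n c
  descend {n = n} {c = c} child =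
    profile-descent (depth n) (depth≤height n)
      (λ j<n → trans (child _) ([]≔-miss (profile n c) (<⇒≢ j<n)))
      (subst₂ _<ᴱ_ (sym (trans (child _) ([]≔-hit (profile n c) (depth n))))
                   (sym (profile-beyond n c ≤-refl))
                   ₁∼₂)

  bodyOf : ∀ {θ} → IsFix θ → Path φ₀ θ → Σ Fm (Path φ₀)
  bodyOf isμ b = _ , μc b
  bodyOf isν b = _ , νc b

  profile-bodyOf : ∀ {θ} (f : IsFix θ) (b : Path φ₀ θ) c →
                   profile (bodyOf f b .proj₂) c ≗ profile b c [ depth b ]≔ inj₁ (c (θ , f , b))
  profile-bodyOf isμ b c _ = refl
  profile-bodyOf isν b c _ = refl

  binderNode : Binder → FixNode φ₀
  binderNode (muB X ψ b) = μ X ψ , isμ , b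
  binderNode (nuB X ψ b) = ν X ψ , isν , b

  -- prof is the profile of a node of depth d lying inside the body of β
  data Encloses : FixNode φ₀ → ℕ → (Clock → ℕ → Entry) → Set where
    encloses : ∀ {θ} {f : IsFix θ} {b : Path φ₀ θ} {d prof} → depth b < d →
               (∀ c {j} → j ≤ depth b → prof c j ≡ profile (bodyOf f b .proj₂) c j) →
               Encloses (θ , f , b) d prof

  encloses-child : ∀ {β ψ} (p : Path φ₀ ψ) {x : Clock → Entry} → Encloses β (depth p) (profile p) →
                   Encloses β (suc (depth p)) (λ c → profile p c [ depth p ]≔ x c)
  encloses-child p (encloses b<p encl) = encloses (m≤n⇒m≤1+n b<p) λ c j≤b →
    trans ([]≔-miss (profile p c) (<⇒≢ (≤-<-trans j≤b b<p))) (encl c j≤b)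

  findBinder-encloses : ∀ X {ψ} (v : Path φ₀ ψ) {B} → findBinder X v ≡ just B →
                        Encloses (binderNode B) (depth v) (profile v)
  findBinder-encloses X (∨l p) found = encloses-child p (findBinder-encloses X p found)
  findBinder-encloses X (∨r p) found = encloses-child p (findBinder-encloses X p found)
  findBinder-encloses X (∧l p) found = encloses-child p (findBinder-encloses X p found)
  findBinder-encloses X (∧r p) found = encloses-child p (findBinder-encloses X p found)
  findBinder-encloses X (◇c p) found = encloses-child p (findBinder-encloses X p found)
  findBinder-encloses X (□c p) found = encloses-child p (findBinder-encloses X p found)
  findBinder-encloses X (μc {Y} p) found with X ≡ᵇ Y
  findBinder-encloses X (μc p) refl | true  = encloses ≤-refl λ _ _ → refl
  ... | false = encloses-child p (findBinder-encloses X p found)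
  findBinder-encloses X (νc {Y} p) found with X ≡ᵇ Y
  findBinder-encloses X (νc p) refl | true  = encloses ≤-refl λ _ _ → refl
  ... | false = encloses-child p (findBinder-encloses X p found)

  jump : ∀ {w ψ θ} (f : IsFix θ) (b : Path φ₀ θ) {n : Path φ₀ ψ} {c γ'} →
         Encloses (θ , f , b) (depth n) (profile n) → γ' <ᵒ c (θ , f , b) →
         pos w (bodyOf f b .proj₂) (resetClock c b γ') ≺ pos w n c
  jump {θ = θ} f b {n} {c} {γ'} (encloses _ encl) γ'<γ =
    profile-descent (depth b) (depth≤height b) above (subst₂ _<ᴱ_ (sym new) (sym old) (₁∼₁ γ'<γ))
    where
    open ≡-Reasoning
    c' = resetClock c b γ'
    body = bodyOf f b .proj₂

    above : ∀ {j} → j < depth b → profile body c' j ≡ profile n c j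
    above {j} j<b = begin
      profile body c' j                ≡⟨ profile-bodyOf f b c' j ⟩
      (profile b c' [ depth b ]≔ _) j  ≡⟨ []≔-miss (profile b c') (<⇒≢ j<b) ⟩
      profile b c' j                   ≡⟨ profile-agree b (resetClock-agree b c γ') j ⟩
      profile b c j                    ≡⟨ []≔-miss (profile b c) (<⇒≢ j<b) ⟨
      (profile b c [ depth b ]≔ _) j   ≡⟨ profile-bodyOf f b c j ⟨
      profile body c j                 ≡⟨ encl c (<⇒≤ j<b) ⟨
      profile n c j                    ∎

    new : profile body c' (depth b) ≡ inj₁ γ'
    new = begin
      profile body c' (depth b)                ≡⟨ profile-bodyOf f b c' (depth b) ⟩
      (profile b c' [ depth b ]≔ _) (depth b)  ≡⟨ []≔-hit (profile b c') (depth b) ⟩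
      inj₁ (c' (θ , f , b))                    ≡⟨ cong inj₁ (resetClock-hit f b c γ') ⟩
      inj₁ γ'                                  ∎

    old : profile n c (depth b) ≡ inj₁ (c (θ , f , b))
    old = begin
      profile n c (depth b)                   ≡⟨ encl c ≤-refl ⟩
      profile body c (depth b)                ≡⟨ profile-bodyOf f b c (depth b) ⟩
      (profile b c [ depth b ]≔ _) (depth b)  ≡⟨ []≔-hit (profile b c) (depth b) ⟩
      inj₁ (c (θ , f , b))                    ∎

  moves-descend : ∀ s → Descending _≺_ s (rule s)
  moves-descend (pos _ {prop _}  _ _) = tt
  moves-descend (pos _ {nprop _} _ _) = tt
  moves-descend (pos _ {_ ∨ᶠ _} _ _) true  = descend λ _ → refl
  moves-descend (pos _ {_ ∨ᶠ _} _ _) false = descend λ _ → refl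
  moves-descend (pos _ {_ ∧ᶠ _} _ _) true  = descend λ _ → refl
  moves-descend (pos _ {_ ∧ᶠ _} _ _) false = descend λ _ → refl
  moves-descend (pos _ {◇ _}    _ _) _     = descend λ _ → refl
  moves-descend (pos _ {□ _}    _ _) _     = descend λ _ → refl
  moves-descend (pos _ {μ _ _}  n c) (γ , _) =
    descend ([]≔-cong (cong inj₁ (setClock-hit isμ n c γ)) (profile-agree n (setClock-agree n c γ)))
  moves-descend (pos _ {ν _ _}  n c) (γ , _) =
    descend ([]≔-cong (cong inj₁ (setClock-hit isν n c γ)) (profile-agree n (setClock-agree n c γ)))
  moves-descend (pos _ {var X}  n c) with rf n in found
  ... | nothing          = tt
  ... | just (muB _ _ b) = λ (_ , γ'<γ) → jump isμ b (findBinder-encloses X n found) γ'<γ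
  ... | just (nuB _ _ b) = λ (_ , γ'<γ) → jump isν b (findBinder-encloses X n found) γ'<γ

corollary1 : ExcludedMiddle 0ℓ →
    (𝓜 : Kripke) (w : Kripke.W 𝓜) (φ : Fm) → Sentence φ →
    (Ω : OrdinalsUpTo) → Positive Ω →
    (Game.HasWinningStrategy 𝓜 Ω φ Eloise w
      ⊎ Game.HasWinningStrategy 𝓜 Ω φ Abelard w)
    × ¬ (Game.HasWinningStrategy 𝓜 Ω φ Eloise w
      × Game.HasWinningStrategy 𝓜 Ω φ Abelard w)
corollary1 lem 𝓜 w φ _ Ω _ = determined , λ ((_ , σ-wins) , (_ , τ-wins)) → not-both σ-wins τ-wins
  where
  open Game 𝓜 Ω φ using (HasWinningStrategy; initial)
  open WellFoundedGame 𝓜 Ω φ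
  open Termination 𝓜 Ω φ using (≺-wellFounded; moves-descend)

  determined : HasWinningStrategy Eloise w ⊎ HasWinningStrategy Abelard w
  determined with lem {EloiseRegion (initial w)}
  ... | yes win = inj₁ (eloise lem , eloise-wins lem ≺-wellFounded moves-descend win)
  ... | no ¬win = inj₂ (abelard lem , abelard-wins lem ≺-wellFounded moves-descend ¬win)
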